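{- Let $T$ be a Frobenius monad on a dagger category $\mathcal{C}$. If $f\colon A\to B$ is a morphism of FEM-algebras $(A,a)\to(B,b)$, then $f^\dagger\colon B\to A$ is a morphism of FEM-algebras $(B,b)\to(A,a)$. Consequently the dagger of $\mathcal{C}$ induces a dagger on the category of FEM-algebras of $T$.
   Context: A dagger category has an identity-on-objects contravariant functor $f\mapsto f^\dagger$ with $f^{\dagger\dagger}=f$. A Frobenius monad is a monad $(T,\mu,\eta)$ on $\mathcal{C}$ with $T(f^\dagger)=T(f)^\dagger$ for all $f$ and $T(\mu_A)\circ\mu^\dagger_{T(A)}=\mu_{T(A)}\circ T(\mu_A^\dagger)$ for all $A$. An Eilenberg–Moore algebra $(A,a)$ is a morphism $a\colon T(A)\to A$ with $a\circ T(a)=a\circ\mu_A$ and $a\circ\eta_A=\mathrm{id}_A$; a morphism $(A,a)\to(B,b)$ is $f\colon A\to B$ with $b\circ T(f)=f\circ a$. A Frobenius–Eilenberg–Moore (FEM) algebra is an Eilenberg–Moore algebra $(A,a)$ satisfying $\mu_A\circ T(a)^\dagger=T(a)\circ\mu_A^\dagger\colon T(A)\to T(A)$. The category of FEM-algebras is the full subcategory of Eilenberg–Moore algebras on the FEM-algebras. -}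

module Defs where

open import Level using (Level; _⊔_; suc)
open import Relation.Binary using (Rel; IsEquivalence)

record Category (o m e : Level) : Set (suc (o ⊔ m ⊔ e)) where
  infixr 9 _∘_
  infix  4 _≈_
  field
    Obj   : Set o
    Hom   : Obj → Obj → Set m
    _≈_   : ∀ {A B} → Rel (Hom A B) e
    id    : ∀ {A} → Hom A A
    _∘_   : ∀ {A B C} → Hom B C → Hom A B → Hom A C
    ≈-equiv : ∀ {A B} → IsEquivalence (_≈_ {A} {B})
    ∘-resp-≈ : ∀ {A B C} {f f′ : Hom B C} {g g′ : Hom A B} →
               f ≈ f′ → g ≈ g′ → f ∘ g ≈ f′ ∘ g′
    assoc : ∀ {A B C D} {f : Hom A B} {g : Hom B C} {h : Hom C D} →
            (h ∘ g) ∘ f ≈ h ∘ (g ∘ f)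
    identityˡ : ∀ {A B} {f : Hom A B} → id ∘ f ≈ f
    identityʳ : ∀ {A B} {f : Hom A B} → f ∘ id ≈ f

record DaggerCategory (o m e : Level) : Set (suc (o ⊔ m ⊔ e)) where
  field
    cat : Category o m e
  open Category cat
  field
    _† : ∀ {A B} → Hom A B → Hom B A
    †-resp-≈ : ∀ {A B} {f g : Hom A B} → f ≈ g → f † ≈ g †
    †-identity : ∀ {A} → (id {A}) † ≈ id
    †-homomorphism : ∀ {A B C} {f : Hom A B} {g : Hom B C} →
                     (g ∘ f) † ≈ f † ∘ g †
    †-involutive : ∀ {A B} {f : Hom A B} → (f †) † ≈ f

record Monad {o m e : Level} (C : Category o m e) : Set (o ⊔ m ⊔ e) where
  open Category C
  field
    T₀ : Obj → Obj
    T₁ : ∀ {A B} → Hom A B → Hom (T₀ A) (T₀ B)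
    T-resp-≈ : ∀ {A B} {f g : Hom A B} → f ≈ g → T₁ f ≈ T₁ g
    T-identity : ∀ {A} → T₁ (id {A}) ≈ id
    T-homomorphism : ∀ {A B C} {f : Hom A B} {g : Hom B C} →
                     T₁ (g ∘ f) ≈ T₁ g ∘ T₁ f
    η : ∀ A → Hom A (T₀ A)
    μ : ∀ A → Hom (T₀ (T₀ A)) (T₀ A)
    η-natural : ∀ {A B} {f : Hom A B} → η B ∘ f ≈ T₁ f ∘ η A
    μ-natural : ∀ {A B} {f : Hom A B} → μ B ∘ T₁ (T₁ f) ≈ T₁ f ∘ μ A
    μ-assoc : ∀ {A} → μ A ∘ T₁ (μ A) ≈ μ A ∘ μ (T₀ A)
    μ-identityˡ : ∀ {A} → μ A ∘ T₁ (η A) ≈ id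
    μ-identityʳ : ∀ {A} → μ A ∘ η (T₀ A) ≈ id

module _ {o m e : Level} (D : DaggerCategory o m e) where
  open DaggerCategory D
  open Category cat

  record FrobeniusMonad : Set (o ⊔ m ⊔ e) where
    field
      monad : Monad cat
    open Monad monad
    field
      T-† : ∀ {A B} {f : Hom A B} → T₁ (f †) ≈ (T₁ f) †
      frobenius : ∀ {A} →
        T₁ (μ A) ∘ (μ (T₀ A)) † ≈ μ (T₀ A) ∘ T₁ ((μ A) †)

  module _ (F : FrobeniusMonad) where
    open FrobeniusMonad F
    open Monad monad

    record IsEMAlgebra (A : Obj) (a : Hom (T₀ A) A) : Set e where
      field
        alg-assoc : a ∘ T₁ a ≈ a ∘ μ A
        alg-unit  : a ∘ η A ≈ id

    record IsFEMAlgebra (A : Obj) (a : Hom (T₀ A) A) : Set e where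
      field
        isEM : IsEMAlgebra A a
        fem  : μ A ∘ (T₁ a) † ≈ T₁ a ∘ (μ A) †

    record FEMAlgebra : Set (o ⊔ m ⊔ e) where
      field
        carrier : Obj
        action  : Hom (T₀ carrier) carrier
        isFEM   : IsFEMAlgebra carrier action

    IsAlgMorphism : (X Y : FEMAlgebra) →
                    Hom (FEMAlgebra.carrier X) (FEMAlgebra.carrier Y) → Set e
    IsAlgMorphism X Y f = FEMAlgebra.action Y ∘ T₁ f ≈ f ∘ FEMAlgebra.action X

-- For an FEM-algebra (A, a) the Frobenius law turns the adjoint action into
-- a† = T a ∘ σ_A, where σ_A = μ_A† ∘ η_A : A → T T A is natural in A (by the
-- dagger-dual of the naturality of μ, which needs T(f†) = (T f)†).  Hence an
-- algebra morphism f : (A, a) → (B, b) satisfies T f ∘ a† = b† ∘ f, and taking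
-- the adjoint of this square gives a ∘ T(f†) = f† ∘ b.
module Submission where

open import Level using (Level)
open import Relation.Binary using (Setoid; IsEquivalence)
import Relation.Binary.Reasoning.Setoid as SetoidReasoning
open import Defs

module DaggerCategoryProperties {o m e : Level} (D : DaggerCategory o m e) where
  open DaggerCategory D
  open Category cat

  hom-setoid : ∀ {A B} → Setoid m e
  hom-setoid {A} {B} = record { Carrier = Hom A B ; _≈_ = _≈_ ; isEquivalence = ≈-equiv }

  open module HomReasoning {A B : Obj} = SetoidReasoning (hom-setoid {A} {B}) public
  open module ≈ {A B : Obj} = IsEquivalence (≈-equiv {A} {B}) public
    using () renaming (refl to ≈-refl)

  infixr 4 _⟩∘⟨_
  _⟩∘⟨_ : ∀ {A B C} {f f′ : Hom B C} {g g′ : Hom A B} →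
          f ≈ f′ → g ≈ g′ → f ∘ g ≈ f′ ∘ g′
  _⟩∘⟨_ = ∘-resp-≈

  †-transpose : ∀ {W X Y Z} {f : Hom Y Z} {g : Hom Y W} {h : Hom Z X} {k : Hom W X} →
                f ∘ g † ≈ h † ∘ k → g ∘ f † ≈ k † ∘ h
  †-transpose {f = f} {g} {h} {k} sq = begin
    g ∘ f †         ≈⟨ †-involutive ⟩∘⟨ ≈-refl ⟨
    g † † ∘ f †     ≈⟨ †-homomorphism ⟨
    (f ∘ g †) †     ≈⟨ †-resp-≈ sq ⟩
    (h † ∘ k) †     ≈⟨ †-homomorphism ⟩
    k † ∘ h † †     ≈⟨ ≈-refl ⟩∘⟨ †-involutive ⟩
    k † ∘ h         ∎

module FrobeniusMonadProperties {o m e : Level} (D : DaggerCategory o m e)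
                                (F : FrobeniusMonad D) where
  open DaggerCategory D
  open Category cat
  open FrobeniusMonad F
  open Monad monad
  open DaggerCategoryProperties D

  μ†-natural : ∀ {A B} {f : Hom A B} → T₁ (T₁ f) ∘ μ A † ≈ μ B † ∘ T₁ f
  μ†-natural {A} {B} {f} = †-transpose (begin
    μ A ∘ T₁ (T₁ f) †    ≈⟨ ≈-refl ⟩∘⟨ T-† ⟨
    μ A ∘ T₁ (T₁ f †)    ≈⟨ ≈-refl ⟩∘⟨ T-resp-≈ T-† ⟨
    μ A ∘ T₁ (T₁ (f †))  ≈⟨ μ-natural ⟩
    T₁ (f †) ∘ μ B       ≈⟨ T-† ⟩∘⟨ ≈-refl ⟩
    T₁ f † ∘ μ B         ∎)

  σ : ∀ A → Hom A (T₀ (T₀ A))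
  σ A = μ A † ∘ η A

  σ-natural : ∀ {A B} {f : Hom A B} → T₁ (T₁ f) ∘ σ A ≈ σ B ∘ f
  σ-natural {A} {B} {f} = begin
    T₁ (T₁ f) ∘ (μ A † ∘ η A)   ≈⟨ assoc ⟨
    (T₁ (T₁ f) ∘ μ A †) ∘ η A   ≈⟨ μ†-natural ⟩∘⟨ ≈-refl ⟩
    (μ B † ∘ T₁ f) ∘ η A        ≈⟨ assoc ⟩
    μ B † ∘ (T₁ f ∘ η A)        ≈⟨ ≈-refl ⟩∘⟨ η-natural ⟨
    μ B † ∘ (η B ∘ f)           ≈⟨ assoc ⟨
    σ B ∘ f                     ∎

  frobenius-law⇒action-† : ∀ {A} {a : Hom (T₀ A) A} →
    μ A ∘ T₁ a † ≈ T₁ a ∘ μ A † → a † ≈ T₁ a ∘ σ A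
  frobenius-law⇒action-† {A} {a} fem = begin
    a †                          ≈⟨ identityˡ ⟨
    id ∘ a †                     ≈⟨ μ-identityʳ ⟩∘⟨ ≈-refl ⟨
    (μ A ∘ η (T₀ A)) ∘ a †       ≈⟨ assoc ⟩
    μ A ∘ (η (T₀ A) ∘ a †)       ≈⟨ ≈-refl ⟩∘⟨ η-natural ⟩
    μ A ∘ (T₁ (a †) ∘ η A)       ≈⟨ ≈-refl ⟩∘⟨ T-† ⟩∘⟨ ≈-refl ⟩
    μ A ∘ (T₁ a † ∘ η A)         ≈⟨ assoc ⟨
    (μ A ∘ T₁ a †) ∘ η A         ≈⟨ fem ⟩∘⟨ ≈-refl ⟩
    (T₁ a ∘ μ A †) ∘ η A         ≈⟨ assoc ⟩
    T₁ a ∘ σ A                   ∎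

  action-†-natural : ∀ {A B} {a : Hom (T₀ A) A} {b : Hom (T₀ B) B} {f : Hom A B} →
    a † ≈ T₁ a ∘ σ A → b † ≈ T₁ b ∘ σ B →
    b ∘ T₁ f ≈ f ∘ a → T₁ f ∘ a † ≈ b † ∘ f
  action-†-natural {A} {B} {a} {b} {f} a† b† hom = begin
    T₁ f ∘ a †                   ≈⟨ ≈-refl ⟩∘⟨ a† ⟩
    T₁ f ∘ (T₁ a ∘ σ A)          ≈⟨ assoc ⟨
    (T₁ f ∘ T₁ a) ∘ σ A          ≈⟨ T-homomorphism ⟩∘⟨ ≈-refl ⟨
    T₁ (f ∘ a) ∘ σ A             ≈⟨ T-resp-≈ hom ⟩∘⟨ ≈-refl ⟨
    T₁ (b ∘ T₁ f) ∘ σ A          ≈⟨ T-homomorphism ⟩∘⟨ ≈-refl ⟩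
    (T₁ b ∘ T₁ (T₁ f)) ∘ σ A     ≈⟨ assoc ⟩
    T₁ b ∘ (T₁ (T₁ f) ∘ σ A)     ≈⟨ ≈-refl ⟩∘⟨ σ-natural ⟩
    T₁ b ∘ (σ B ∘ f)             ≈⟨ assoc ⟨
    (T₁ b ∘ σ B) ∘ f             ≈⟨ b† ⟩∘⟨ ≈-refl ⟨
    b † ∘ f                      ∎

proposition6p5 : ∀ {o m e : Level} (D : DaggerCategory o m e)
    (F : FrobeniusMonad D) (X Y : FEMAlgebra D F)
    (f : Category.Hom (DaggerCategory.cat D) (FEMAlgebra.carrier X) (FEMAlgebra.carrier Y)) →
    IsAlgMorphism D F X Y f →
    IsAlgMorphism D F Y X (DaggerCategory._† D f)
proposition6p5 D F X Y f hom = begin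
    FEMAlgebra.action X ∘ T₁ (f †)   ≈⟨ ≈-refl ⟩∘⟨ T-† ⟩
    FEMAlgebra.action X ∘ T₁ f †     ≈⟨ †-transpose (action-†-natural (action-† X) (action-† Y) hom) ⟩
    f † ∘ FEMAlgebra.action Y        ∎
  where
    open DaggerCategory D
    open Category cat
    open Monad (FrobeniusMonad.monad F)
    open FrobeniusMonad F using (T-†)
    open DaggerCategoryProperties D
    open FrobeniusMonadProperties D F

    action-† : ∀ Z → FEMAlgebra.action Z † ≈ T₁ (FEMAlgebra.action Z) ∘ σ (FEMAlgebra.carrier Z)
    action-† Z = frobenius-law⇒action-† (IsFEMAlgebra.fem (FEMAlgebra.isFEM Z))
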